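{- Let $Z$ be a finite set of even integers. If $Z$ is empty, or $Z$ contains at least one positive and at least one negative integer, then $Z\cup\{0\}$ is the imbalance set of a tournament.
   Context: A tournament is an orientation of a complete simple graph. The imbalance of a vertex $v$ in a digraph is $d^{+}(v)-d^{ - }(v)$ (outdegree minus indegree), and the imbalance set of a digraph is the set of imbalances of its vertices. -}

module Defs where

open import Data.Nat using (ℕ)
open import Data.Bool using (Bool; true; false; not)
open import Data.Fin using (Fin)
open import Data.Integer using (ℤ; +_; _-_)
open import Data.List using (List; filter; allFin; length)
open import Data.Bool.Properties using (T?)
open import Relation.Binary.PropositionalEquality using (_≡_)
open import Relation.Nullary using (¬_)

-- A tournament on the vertex set Fin n: an orientation of the complete
-- simple graph K_n.  arc u v = true means the edge {u,v} is oriented u → v.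
record Tournament (n : ℕ) : Set where
  field
    arc        : Fin n → Fin n → Bool
    loopless   : ∀ u → arc u u ≡ false
    orientation : ∀ u v → ¬ (u ≡ v) → arc v u ≡ not (arc u v)
open Tournament public

outdeg : ∀ {n} → Tournament n → Fin n → ℕ
outdeg t u = length (filter (λ v → T? (arc t u v)) (allFin _))

indeg : ∀ {n} → Tournament n → Fin n → ℕ
indeg t u = length (filter (λ v → T? (arc t v u)) (allFin _))

imbalance : ∀ {n} → Tournament n → Fin n → ℤ
imbalance t v = + outdeg t v - + indeg t v

-- The rotational tournament on 2h+1 vertices (i → j iff j is among the h successors of i
-- around the circle) is regular, so every imbalance is 0.  Lay out disjoint blocks, each of
-- k losers followed by l winners, on its first h vertices.  Vertices of one block are within
-- distance h of each other, so all arcs between its losers and winners go from loser to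
-- winner; reversing them gives every winner imbalance 2k and every loser -2l, and leaves
-- all other imbalances 0.  A positive 2a ∈ Z is then realised by the winners of a block
-- (a , q) and a negative -2b by the losers of a block (p , b), where 2p and -2q are fixed
-- members of Z, so that no imbalance outside {0} ∪ Z arises.
module Submission where

open import Data.Bool using (Bool; true; false; not; _xor_; if_then_else_; T)
open import Data.Bool.Properties using (T?; not-involutive; xor-comm; not-distribˡ-xor)
open import Data.Empty using (⊥-elim)
open import Data.Fin using (Fin; toℕ; fromℕ<)
open import Data.Fin.Properties using (toℕ-injective; toℕ<n; toℕ-fromℕ<)
open import Data.Integer using (ℤ; +_; +0; -[1+_]; +[1+_]; -_; _⊖_; _<_; +<+)
open import Data.Integer.Divisibility using (_∣_)
open import Data.Integer.Properties using ([+m]-[+n]≡m⊖n; +-cancelˡ-⊖; ⊖-swap)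
open import Data.List using (List; []; _∷_; map; filter; length; tabulate)
open import Data.List.Membership.Propositional using (_∈_)
open import Data.List.Membership.Propositional.Properties using (∈-map⁺; ∈-map⁻)
open import Data.List.Relation.Unary.All as All using (All)
open import Data.List.Relation.Unary.Any using (here; there)
open import Data.Nat as ℕ using (ℕ; zero; suc; _+_; _*_; _∸_; _<ᵇ_; _≤ᵇ_; z<s; s<s; s≤s)
open import Data.Nat.DivMod using (_/_; m*[n/m]≡n)
open import Data.Nat.Divisibility using () renaming (_∣_ to _∣ℕ_)
open import Data.Nat.Properties
open import Data.Nat.Tactic.RingSolver using (solve-∀)
open import Data.Product using (Σ; ∃; _×_; _,_; proj₁; proj₂)
open import Data.Sum using (_⊎_; inj₁; inj₂)
open import Function using (_∘_)
open import Function.Bundles using (_⇔_; mk⇔)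
open import Relation.Binary.PropositionalEquality
open import Relation.Nullary using (¬_; yes; no; contradiction)
open import Relation.Binary.Definitions using (tri<; tri≈; tri>)

open import Defs

bit : Bool → ℕ
bit true  = 1
bit false = 0

count : ℕ → (ℕ → Bool) → ℕ
count zero    f = 0
count (suc n) f = bit (f 0) + count n (f ∘ suc)

count-cong : ∀ n {f g : ℕ → Bool} → (∀ j → j ℕ.< n → f j ≡ g j) → count n f ≡ count n g
count-cong zero    f≗g = refl
count-cong (suc n) f≗g =
  cong₂ _+_ (cong bit (f≗g 0 z<s)) (count-cong n (λ j j<n → f≗g (suc j) (s<s j<n)))

count-+ : ∀ a b (f : ℕ → Bool) → count (a + b) f ≡ count a f + count b (λ j → f (a + j))
count-+ zero    b f = refl
count-+ (suc a) b f =
  trans (cong (λ c → bit (f 0) + c) (count-+ a b (f ∘ suc))) (sym (+-assoc (bit (f 0)) _ _))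

count-true : ∀ n {f : ℕ → Bool} → (∀ j → j ℕ.< n → f j ≡ true) → count n f ≡ n
count-true zero    f≡t = refl
count-true (suc n) f≡t rewrite f≡t 0 z<s = cong suc (count-true n (λ j j<n → f≡t (suc j) (s<s j<n)))

count-false : ∀ n {f : ℕ → Bool} → (∀ j → j ℕ.< n → f j ≡ false) → count n f ≡ 0
count-false zero    f≡f = refl
count-false (suc n) f≡f rewrite f≡f 0 z<s = count-false n (λ j j<n → f≡f (suc j) (s<s j<n))

count-xor-disjoint : ∀ n (f g : ℕ → Bool) → (∀ j → g j ≡ true → f j ≡ false) →
                     count n (λ j → f j xor g j) ≡ count n f + count n g
count-xor-disjoint zero    f g disj = refl
count-xor-disjoint (suc n) f g disj with f 0 in f0 | g 0 in g0
... | true  | true  with () ← trans (sym f0) (disj 0 g0)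
... | true  | false = cong suc (count-xor-disjoint n _ _ (disj ∘ suc))
... | false | true  = trans (cong suc (count-xor-disjoint n _ _ (disj ∘ suc))) (sym (+-suc _ _))
... | false | false = count-xor-disjoint n _ _ (disj ∘ suc)

count-xor-⊆ : ∀ n (f g : ℕ → Bool) → (∀ j → g j ≡ true → f j ≡ true) →
              count n (λ j → f j xor g j) + count n g ≡ count n f
count-xor-⊆ zero    f g g⊆f = refl
count-xor-⊆ (suc n) f g g⊆f with f 0 in f0 | g 0 in g0
... | true  | true  = trans (+-suc _ _) (cong suc (count-xor-⊆ n _ _ (g⊆f ∘ suc)))
... | true  | false = cong suc (count-xor-⊆ n _ _ (g⊆f ∘ suc))
... | false | true  with () ← trans (sym (g⊆f 0 g0)) f0
... | false | false = count-xor-⊆ n _ _ (g⊆f ∘ suc)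

count-complement : ∀ n (f g : ℕ → Bool) → (∀ j → g j ≡ not (f j)) → count n f + count n g ≡ n
count-complement zero    f g g≡¬f = refl
count-complement (suc n) f g g≡¬f with f 0 | g 0 | g≡¬f 0
... | true  | false | _ = cong suc (count-complement n _ _ (g≡¬f ∘ suc))
... | false | true  | _ = trans (+-suc _ _) (cong suc (count-complement n _ _ (g≡¬f ∘ suc)))

count-complement-except : ∀ n i (f g : ℕ → Bool) → i ℕ.< suc n → f i ≡ false → g i ≡ false →
                          (∀ j → j ≢ i → g j ≡ not (f j)) → count (suc n) f + count (suc n) g ≡ n
count-complement-except n zero f g _ fi gi g≡¬f rewrite fi | gi =
  count-complement n _ _ (λ j → g≡¬f (suc j) (λ ()))
count-complement-except (suc n) (suc i) f g (s<s i<n) fi gi g≡¬f with f 0 | g 0 | g≡¬f 0 (λ ())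
... | true  | false | _ = cong suc rest
  where rest = count-complement-except n i _ _ i<n fi gi (λ j j≢i → g≡¬f (suc j) (j≢i ∘ suc-injective))
... | false | true  | _ = trans (+-suc _ _) (cong suc rest)
  where rest = count-complement-except n i _ _ i<n fi gi (λ j j≢i → g≡¬f (suc j) (j≢i ∘ suc-injective))

length-filter-tabulate : ∀ {m} n (σ : Fin n → Fin m) (P : Fin m → Bool) (g : ℕ → Bool) →
                         (∀ i → P (σ i) ≡ g (toℕ i)) →
                         length (filter (λ v → T? (P v)) (tabulate σ)) ≡ count n g
length-filter-tabulate zero    σ P g P≗g = refl
length-filter-tabulate (suc n) σ P g P≗g rewrite P≗g Fin.zero with g 0
... | true  = cong suc (length-filter-tabulate n (σ ∘ Fin.suc) P (g ∘ suc) (P≗g ∘ Fin.suc))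
... | false = length-filter-tabulate n (σ ∘ Fin.suc) P (g ∘ suc) (P≗g ∘ Fin.suc)

T⇒≡true : ∀ {b} → T b → b ≡ true
T⇒≡true {true} _ = refl

¬T⇒≡false : ∀ {b} → ¬ T b → b ≡ false
¬T⇒≡false {false} _  = refl
¬T⇒≡false {true}  ¬t = ⊥-elim (¬t _)

<ᵇ-true : ∀ {m n} → m ℕ.< n → (m <ᵇ n) ≡ true
<ᵇ-true = T⇒≡true ∘ <⇒<ᵇ

<ᵇ-false : ∀ {m n} → n ℕ.≤ m → (m <ᵇ n) ≡ false
<ᵇ-false n≤m = ¬T⇒≡false (λ m<ᵇn → <⇒≱ (<ᵇ⇒< _ _ m<ᵇn) n≤m)

≤ᵇ-true : ∀ {m n} → m ℕ.≤ n → (m ≤ᵇ n) ≡ true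
≤ᵇ-true = T⇒≡true ∘ ≤⇒≤ᵇ

≤ᵇ-false : ∀ {m n} → n ℕ.< m → (m ≤ᵇ n) ≡ false
≤ᵇ-false n<m = ¬T⇒≡false (λ m≤ᵇn → <⇒≱ n<m (≤ᵇ⇒≤ _ _ m≤ᵇn))

-- On 2h+1 vertices arranged in a circle, i → j iff j is one of the h successors of i.
rotational : ℕ → ℕ → ℕ → Bool
rotational h i j =
  if i <ᵇ j then j ≤ᵇ i + h else (if j <ᵇ i then not (i ≤ᵇ j + h) else false)

rotational-irrefl : ∀ h i → rotational h i i ≡ false
rotational-irrefl h i rewrite <ᵇ-false (≤-refl {i}) = refl

rotational-antisym : ∀ h i j → i ≢ j → rotational h j i ≡ not (rotational h i j)
rotational-antisym h i j i≢j with <-cmp i j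
... | tri< i<j _ _ rewrite <ᵇ-false (<⇒≤ i<j) | <ᵇ-true i<j = refl
... | tri≈ _ i≡j _ = ⊥-elim (i≢j i≡j)
... | tri> _ _ j<i rewrite <ᵇ-false (<⇒≤ j<i) | <ᵇ-true j<i = sym (not-involutive _)

rotational-near-forward : ∀ h {i j} → i ℕ.< j → j ℕ.≤ i + h → rotational h i j ≡ true
rotational-near-forward h i<j j≤i+h rewrite <ᵇ-true i<j | ≤ᵇ-true j≤i+h = refl

rotational-far-forward : ∀ h {i j} → i ℕ.< j → i + h ℕ.< j → rotational h i j ≡ false
rotational-far-forward h i<j i+h<j rewrite <ᵇ-true i<j | ≤ᵇ-false i+h<j = refl

rotational-near-backward : ∀ h {i j} → j ℕ.< i → i ℕ.≤ j + h → rotational h i j ≡ false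
rotational-near-backward h j<i i≤j+h rewrite <ᵇ-false (<⇒≤ j<i) | <ᵇ-true j<i | ≤ᵇ-true i≤j+h = refl

rotational-far-backward : ∀ h {i j} → j ℕ.< i → j + h ℕ.< i → rotational h i j ≡ true
rotational-far-backward h j<i j+h<i rewrite <ᵇ-false (<⇒≤ j<i) | <ᵇ-true j<i | ≤ᵇ-false j+h<i = refl

-- Vertex i ≤ h: its successors i+1, …, i+h do not wrap around.
count-rotational-low : ∀ i d → count ((i + d) + suc (i + d)) (rotational (i + d) i) ≡ i + d
count-rotational-low i d = begin
    count (h + suc h) f
  ≡⟨ cong (λ m → count m f) (layout i d) ⟩
    count (i + suc (h + d)) f
  ≡⟨ count-+ i (suc (h + d)) f ⟩
    count i f + (bit (f (i + 0)) + count (h + d) (λ j → f (i + suc j)))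
  ≡⟨ cong₂ _+_ before (cong₂ _+_ (cong bit self) (count-+ h d (λ j → f (i + suc j)))) ⟩
    0 + (0 + (count h (λ j → f (i + suc j)) + count d (λ j → f (i + suc (h + j)))))
  ≡⟨ cong₂ _+_ successors rest ⟩
    h + 0
  ≡⟨ +-identityʳ h ⟩
    h ∎
  where
  open ≡-Reasoning
  h = i + d
  f = rotational h i
  layout : ∀ i d → (i + d) + suc (i + d) ≡ i + suc ((i + d) + d)
  layout = solve-∀
  before : count i f ≡ 0
  before = count-false i (λ j j<i → rotational-near-backward h j<i (≤-trans (m≤m+n i d) (m≤n+m h j)))
  self : f (i + 0) ≡ false
  self rewrite +-identityʳ i = rotational-irrefl h i
  successors : count h (λ j → f (i + suc j)) ≡ h
  successors = count-true h (λ j j<h → rotational-near-forward h (m<m+n i z<s) (+-monoʳ-≤ i j<h))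
  rest : count d (λ j → f (i + suc (h + j))) ≡ 0
  rest = count-false d (λ j _ → rotational-far-forward h (m<m+n i z<s) (+-monoʳ-< i (s≤s (m≤m+n h j))))

-- Vertex i = h + 1 + t: its successors are the e = h - 1 - t vertices after it and, wrapping
-- around, the vertices 0, …, t.
count-rotational-high : ∀ t e → let h = suc (t + e) in
                        count (h + suc h) (rotational h (suc (h + t))) ≡ h
count-rotational-high t e = begin
    count (h + suc h) f
  ≡⟨ cong (λ m → count m f) (layout t e) ⟩
    count (suc t + (h + suc e)) f
  ≡⟨ count-+ (suc t) (h + suc e) f ⟩
    count (suc t) f + count (h + suc e) (λ j → f (suc t + j))
  ≡⟨ cong (λ x → count (suc t) f + x) (count-+ h (suc e) (λ j → f (suc t + j))) ⟩
    count (suc t) f + (count h (λ j → f (suc t + j))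
                      + (bit (f (suc t + (h + 0))) + count e (λ j → f (suc t + (h + suc j)))))
  ≡⟨ cong₂ _+_ wrapped (cong₂ _+_ predecessors (cong₂ _+_ (cong bit self) successors)) ⟩
    suc t + e ∎
  where
  open ≡-Reasoning
  h = suc (t + e)
  i = suc (h + t)
  f = rotational h i
  layout : ∀ t e → suc (t + e) + suc (suc (t + e)) ≡ suc t + (suc (t + e) + suc e)
  layout = solve-∀
  wrapped : count (suc t) f ≡ suc t
  wrapped = count-true (suc t) (λ j j≤t → rotational-far-backward h
    (≤-trans j≤t (s≤s (m≤n+m t h)))
    (s≤s (subst (j + h ℕ.≤_) (+-comm t h) (+-monoˡ-≤ h (≤-pred j≤t)))))
  shift : ∀ j → h + t + j ≡ t + j + h
  shift j = solve-∀' h t j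
    where solve-∀' : ∀ a b c → a + b + c ≡ b + c + a
          solve-∀' = solve-∀
  predecessors : count h (λ j → f (suc t + j)) ≡ 0
  predecessors = count-false h (λ j j<h → rotational-near-backward h
    (s≤s (subst (t + j ℕ.<_) (+-comm t h) (+-monoʳ-< t j<h)))
    (s≤s (≤-trans (m≤m+n (h + t) j) (≤-reflexive (shift j)))))
  self : f (suc t + (h + 0)) ≡ false
  self = subst (λ x → f x ≡ false) (cong suc (sym (trans (cong (λ x → t + x) (+-identityʳ h)) (+-comm t h))))
           (rotational-irrefl h i)
  after : ∀ j → i + suc j ≡ suc t + (h + suc j)
  after j = after′ h t j
    where after′ : ∀ a b c → suc (a + b) + suc c ≡ suc b + (a + suc c)
          after′ = solve-∀
  successors : count e (λ j → f (suc t + (h + suc j))) ≡ e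
  successors = count-true e (λ j j<e → rotational-near-forward h
    (subst (i ℕ.<_) (after j) (m<m+n i z<s))
    (subst (ℕ._≤ i + h) (after j) (+-monoʳ-≤ i (≤-trans j<e (≤-trans (m≤n+m e t) (n≤1+n _))))))

count-rotational : ∀ h {i} → i ℕ.< h + suc h → count (h + suc h) (rotational h i) ≡ h
count-rotational h {i} i<n with i ≤? h
... | yes i≤h with d , refl ← m≤n⇒∃[o]m+o≡n i≤h = count-rotational-low i d
... | no i≰h with t , refl ← m≤n⇒∃[o]m+o≡n (≰⇒> i≰h)
             with e , refl ← m≤n⇒∃[o]m+o≡n
                               (+-cancelˡ-< (suc h) t h (subst (suc h + t ℕ.<_) (+-comm h (suc h)) i<n))
             = count-rotational-high t e

-- A block (k , l) consists of k losers followed by l winners; the vertices 0, 1, … are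
-- filled by the blocks of the list in order.
data Role : Set where
  loser winner : ℕ → Role
  bystander    : Role

role : List (ℕ × ℕ) → ℕ → Role
role []             i = bystander
role ((k , l) ∷ bs) i =
  if i <ᵇ k then loser l else (if i <ᵇ k + l then winner k else role bs (i ∸ (k + l)))

width : List (ℕ × ℕ) → ℕ
width []             = 0
width ((k , l) ∷ bs) = (k + l) + width bs

-- The pairs joining a loser and a winner of the same block.
reversal : List (ℕ × ℕ) → ℕ → ℕ → Bool
reversal []             i j = false
reversal ((k , l) ∷ bs) i j =
  if i <ᵇ k + l
  then (if j <ᵇ k + l then (i <ᵇ k) xor (j <ᵇ k) else false)
  else (if j <ᵇ k + l then false else reversal bs (i ∸ (k + l)) (j ∸ (k + l)))

reversedDegree : Role → ℕ
reversedDegree (loser l)  = l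
reversedDegree (winner k) = k
reversedDegree bystander  = 0

module _ {k l : ℕ} {bs : List (ℕ × ℕ)} where

  reversal-inside : ∀ {i j} → i ℕ.< k + l → j ℕ.< k + l →
                    reversal ((k , l) ∷ bs) i j ≡ (i <ᵇ k) xor (j <ᵇ k)
  reversal-inside i<s j<s rewrite <ᵇ-true i<s | <ᵇ-true j<s = refl

  reversal-inside-outside : ∀ {i j} → i ℕ.< k + l → k + l ℕ.≤ j → reversal ((k , l) ∷ bs) i j ≡ false
  reversal-inside-outside i<s s≤j rewrite <ᵇ-true i<s | <ᵇ-false s≤j = refl

  reversal-outside-inside : ∀ {i j} → k + l ℕ.≤ i → j ℕ.< k + l → reversal ((k , l) ∷ bs) i j ≡ false
  reversal-outside-inside s≤i j<s rewrite <ᵇ-false s≤i | <ᵇ-true j<s = refl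

  reversal-outside : ∀ {i j} → k + l ℕ.≤ i → k + l ℕ.≤ j →
                     reversal ((k , l) ∷ bs) i j ≡ reversal bs (i ∸ (k + l)) (j ∸ (k + l))
  reversal-outside s≤i s≤j rewrite <ᵇ-false s≤i | <ᵇ-false s≤j = refl

  role-loser : ∀ {i} → i ℕ.< k → role ((k , l) ∷ bs) i ≡ loser l
  role-loser i<k rewrite <ᵇ-true i<k = refl

  role-winner : ∀ {i} → k ℕ.≤ i → i ℕ.< k + l → role ((k , l) ∷ bs) i ≡ winner k
  role-winner k≤i i<s rewrite <ᵇ-false k≤i | <ᵇ-true i<s = refl

  role-outside : ∀ {i} → k + l ℕ.≤ i → role ((k , l) ∷ bs) i ≡ role bs (i ∸ (k + l))
  role-outside s≤i rewrite <ᵇ-false (≤-trans (m≤m+n k l) s≤i) | <ᵇ-false s≤i = refl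

reversal-sym : ∀ bs i j → reversal bs i j ≡ reversal bs j i
reversal-sym []             i j = refl
reversal-sym ((k , l) ∷ bs) i j with i <ᵇ k + l | j <ᵇ k + l
... | true  | true  = xor-comm (i <ᵇ k) (j <ᵇ k)
... | true  | false = refl
... | false | true  = refl
... | false | false = reversal-sym bs _ _

reversal-irrefl : ∀ bs i → reversal bs i i ≡ false
reversal-irrefl []             i = refl
reversal-irrefl ((k , l) ∷ bs) i with i <ᵇ k + l
... | true  with i <ᵇ k
...   | true  = refl
...   | false = refl
reversal-irrefl ((k , l) ∷ bs) i | false = reversal-irrefl bs _

count-<ᵇ : ∀ k l → count (k + l) (_<ᵇ k) ≡ k
count-<ᵇ k l = begin
  count (k + l) (_<ᵇ k)                            ≡⟨ count-+ k l _ ⟩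
  count k (_<ᵇ k) + count l (λ j → k + j <ᵇ k)     ≡⟨ cong₂ _+_ (count-true k (λ _ → <ᵇ-true))
                                                               (count-false l (λ j _ → <ᵇ-false (m≤m+n k j))) ⟩
  k + 0                                            ≡⟨ +-identityʳ k ⟩
  k                                                ∎
  where open ≡-Reasoning

count-≮ᵇ : ∀ k l → count (k + l) (λ j → not (j <ᵇ k)) ≡ l
count-≮ᵇ k l = trans (count-+ k l _)
  (cong₂ _+_ (count-false k (λ _ j<k → cong not (<ᵇ-true j<k)))
             (count-true l (λ j _ → cong not (<ᵇ-false (m≤m+n k j)))))

count-reversal : ∀ bs i m → count (width bs + m) (reversal bs i) ≡ reversedDegree (role bs i)
count-reversal []             i m = count-false m (λ _ _ → refl)
count-reversal ((k , l) ∷ bs) i m = begin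
    count ((k + l) + width bs + m) R
  ≡⟨ cong (λ x → count x R) (+-assoc (k + l) (width bs) m) ⟩
    count ((k + l) + (width bs + m)) R
  ≡⟨ count-+ (k + l) (width bs + m) R ⟩
    count (k + l) R + count (width bs + m) (λ j → R ((k + l) + j))
  ≡⟨ by-position ⟩
    reversedDegree (role ((k , l) ∷ bs) i) ∎
  where
  open ≡-Reasoning
  s = k + l
  R = reversal ((k , l) ∷ bs) i
  no-later-partner : i ℕ.< s → count (width bs + m) (λ j → R (s + j)) ≡ 0
  no-later-partner i<s = count-false (width bs + m) (λ j _ → reversal-inside-outside {k} {l} {bs} i<s (m≤m+n s j))
  by-position : count s R + count (width bs + m) (λ j → R (s + j)) ≡ reversedDegree (role ((k , l) ∷ bs) i)
  by-position with i <? k | i <? s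
  ... | yes i<k | _ rewrite role-loser {k} {l} {bs} i<k = begin
      count s R + count (width bs + m) (λ j → R (s + j))
    ≡⟨ cong₂ _+_ (count-cong s (λ j j<s → trans (reversal-inside {k} {l} {bs} i<s j<s)
                                                (cong (_xor (j <ᵇ k)) (<ᵇ-true i<k))))
                 (no-later-partner i<s) ⟩
      count (k + l) (λ j → not (j <ᵇ k)) + 0
    ≡⟨ cong (_+ 0) (count-≮ᵇ k l) ⟩
      l + 0
    ≡⟨ +-identityʳ l ⟩
      l ∎
    where i<s = ≤-trans i<k (m≤m+n k l)
  ... | no i≮k | yes i<s rewrite role-winner {k} {l} {bs} (≮⇒≥ i≮k) i<s = begin
      count s R + count (width bs + m) (λ j → R (s + j))
    ≡⟨ cong₂ _+_ (count-cong s (λ j j<s → trans (reversal-inside {k} {l} {bs} i<s j<s)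
                                                (cong (_xor (j <ᵇ k)) (<ᵇ-false (≮⇒≥ i≮k)))))
                 (no-later-partner i<s) ⟩
      count (k + l) (_<ᵇ k) + 0
    ≡⟨ cong (_+ 0) (count-<ᵇ k l) ⟩
      k + 0
    ≡⟨ +-identityʳ k ⟩
      k ∎
  ... | no _ | no i≮s rewrite role-outside {k} {l} {bs} (≮⇒≥ i≮s) = begin
      count s R + count (width bs + m) (λ j → R (s + j))
    ≡⟨ cong₂ _+_ (count-false s (λ j j<s → reversal-outside-inside {k} {l} {bs} (≮⇒≥ i≮s) j<s))
                 (count-cong (width bs + m) (λ j _ → trans (reversal-outside {k} {l} {bs} (≮⇒≥ i≮s) (m≤m+n s j))
                                              (cong (reversal bs (i ∸ s)) (m+n∸m≡n s j)))) ⟩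
      0 + count (width bs + m) (reversal bs (i ∸ s))
    ≡⟨ count-reversal bs (i ∸ s) m ⟩
      reversedDegree (role bs (i ∸ s)) ∎

private
  shift-< : ∀ {a b s} → s ℕ.≤ a → s ℕ.≤ b → a ∸ s ℕ.< b ∸ s → a ℕ.< b
  shift-< {s = s} s≤a s≤b a-s<b-s = subst₂ ℕ._<_ (m∸n+n≡m s≤a) (m∸n+n≡m s≤b) (+-monoˡ-< s a-s<b-s)

  shift-≤ : ∀ {a b s w} → s ℕ.≤ a → s ℕ.≤ b → a ∸ s ℕ.≤ (b ∸ s) + w → a ℕ.≤ b + (s + w)
  shift-≤ {a} {b} {s} {w} s≤a s≤b a-s≤ =
    ≤-trans (subst₂ ℕ._≤_ (m∸n+n≡m s≤a) (trans (swap (b ∸ s) w s) (cong (_+ w) (m∸n+n≡m s≤b)))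
                         (+-monoˡ-≤ s a-s≤))
            (+-monoʳ-≤ b (m≤n+m w s))
    where swap : ∀ x y z → x + y + z ≡ x + z + y
          swap = solve-∀

reversal-winner : ∀ bs i j {k} → role bs i ≡ winner k → reversal bs i j ≡ true →
                  j ℕ.< i × i ℕ.≤ j + width bs
reversal-winner ((k′ , l′) ∷ bs) i j ρ r with i <? k′ | i <? k′ + l′ | j <? k′ + l′
... | yes i<k | _ | _ with () ← trans (sym ρ) (role-loser {k′} {l′} {bs} i<k)
... | no i≮k | yes i<s | yes j<s =
  ≤-trans j<k (≮⇒≥ i≮k) , ≤-trans (<⇒≤ i<s) (≤-trans (m≤m+n (k′ + l′) (width bs)) (m≤n+m _ j))
  where
  j<k = <ᵇ⇒< j k′ (subst T (sym (trans (sym (trans (reversal-inside {k′} {l′} {bs} i<s j<s)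
                                                    (cong (_xor (j <ᵇ k′)) (<ᵇ-false (≮⇒≥ i≮k))))) r)) _)
... | no _ | yes i<s | no j≮s with () ← trans (sym r) (reversal-inside-outside {k′} {l′} {bs} i<s (≮⇒≥ j≮s))
... | no _ | no i≮s | yes j<s with () ← trans (sym r) (reversal-outside-inside {k′} {l′} {bs} (≮⇒≥ i≮s) j<s)
... | no _ | no i≮s | no j≮s =
  shift-< (≮⇒≥ j≮s) (≮⇒≥ i≮s) (proj₁ ih) , shift-≤ (≮⇒≥ i≮s) (≮⇒≥ j≮s) (proj₂ ih)
  where
  ih = reversal-winner bs (i ∸ (k′ + l′)) (j ∸ (k′ + l′))
         (trans (sym (role-outside {k′} {l′} {bs} (≮⇒≥ i≮s))) ρ)
         (trans (sym (reversal-outside {k′} {l′} {bs} (≮⇒≥ i≮s) (≮⇒≥ j≮s))) r)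

reversal-loser : ∀ bs i j {l} → role bs i ≡ loser l → reversal bs i j ≡ true →
                 i ℕ.< j × j ℕ.≤ i + width bs
reversal-loser ((k′ , l′) ∷ bs) i j ρ r with i <? k′ | i <? k′ + l′ | j <? k′ + l′
... | yes i<k | _ | yes j<s =
  ≤-trans i<k k≤j , ≤-trans (<⇒≤ j<s) (≤-trans (m≤m+n (k′ + l′) (width bs)) (m≤n+m _ i))
  where
  i<s = ≤-trans i<k (m≤m+n k′ l′)
  k≤j = ≮⇒≥ λ j<k → contradiction (trans (sym (trans (reversal-inside {k′} {l′} {bs} i<s j<s)
                                                    (cong₂ _xor_ (<ᵇ-true i<k) (<ᵇ-true j<k)))) r)
                                     (λ ())
... | yes i<k | _ | no j≮s
  with () ← trans (sym r) (reversal-inside-outside {k′} {l′} {bs} (≤-trans i<k (m≤m+n k′ l′)) (≮⇒≥ j≮s))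
... | no i≮k | yes i<s | _ with () ← trans (sym ρ) (role-winner {k′} {l′} {bs} (≮⇒≥ i≮k) i<s)
... | no _ | no i≮s | yes j<s with () ← trans (sym r) (reversal-outside-inside {k′} {l′} {bs} (≮⇒≥ i≮s) j<s)
... | no _ | no i≮s | no j≮s =
  shift-< (≮⇒≥ i≮s) (≮⇒≥ j≮s) (proj₁ ih) , shift-≤ (≮⇒≥ j≮s) (≮⇒≥ i≮s) (proj₂ ih)
  where
  ih = reversal-loser bs (i ∸ (k′ + l′)) (j ∸ (k′ + l′))
         (trans (sym (role-outside {k′} {l′} {bs} (≮⇒≥ i≮s))) ρ)
         (trans (sym (reversal-outside {k′} {l′} {bs} (≮⇒≥ i≮s) (≮⇒≥ j≮s))) r)

reversal-bystander : ∀ bs i j → role bs i ≡ bystander → reversal bs i j ≡ false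
reversal-bystander []               i j ρ = refl
reversal-bystander ((k′ , l′) ∷ bs) i j ρ with i <? k′ | i <? k′ + l′ | j <? k′ + l′
... | yes i<k | _ | _ with () ← trans (sym ρ) (role-loser {k′} {l′} {bs} i<k)
... | no i≮k | yes i<s | _ with () ← trans (sym ρ) (role-winner {k′} {l′} {bs} (≮⇒≥ i≮k) i<s)
... | no _ | no i≮s | yes j<s = reversal-outside-inside {k′} {l′} {bs} (≮⇒≥ i≮s) j<s
... | no _ | no i≮s | no j≮s =
  trans (reversal-outside {k′} {l′} {bs} (≮⇒≥ i≮s) (≮⇒≥ j≮s))
        (reversal-bystander bs _ _ (trans (sym (role-outside {k′} {l′} {bs} (≮⇒≥ i≮s))) ρ))

role-beyond-width : ∀ bs j → role bs (width bs + j) ≡ bystander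
role-beyond-width []             j = refl
role-beyond-width ((k , l) ∷ bs) j = begin
  role ((k , l) ∷ bs) ((k + l) + width bs + j)    ≡⟨ cong (role ((k , l) ∷ bs)) (+-assoc (k + l) (width bs) j) ⟩
  role ((k , l) ∷ bs) ((k + l) + (width bs + j))  ≡⟨ role-outside {k} {l} {bs} (m≤m+n (k + l) _) ⟩
  role bs ((k + l) + (width bs + j) ∸ (k + l))    ≡⟨ cong (role bs) (m+n∸m≡n (k + l) _) ⟩
  role bs (width bs + j)                          ≡⟨ role-beyond-width bs j ⟩
  bystander                                       ∎
  where open ≡-Reasoning

role-shift : ∀ k l bs i → role ((k , l) ∷ bs) ((k + l) + i) ≡ role bs i
role-shift k l bs i = trans (role-outside {k} {l} {bs} (m≤m+n (k + l) i)) (cong (role bs) (m+n∸m≡n (k + l) i))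

winner-∈ : ∀ bs i {k} → role bs i ≡ winner k → ∃ λ l → (k , l) ∈ bs
winner-∈ ((k′ , l′) ∷ bs) i ρ with i <? k′ | i <? k′ + l′
... | yes i<k | _ with () ← trans (sym ρ) (role-loser {k′} {l′} {bs} i<k)
... | no i≮k | yes i<s with refl ← trans (sym ρ) (role-winner {k′} {l′} {bs} (≮⇒≥ i≮k) i<s) = l′ , here refl
... | no _ | no i≮s with l , kl∈ ← winner-∈ bs _ (trans (sym (role-outside {k′} {l′} {bs} (≮⇒≥ i≮s))) ρ)
  = l , there kl∈

loser-∈ : ∀ bs i {l} → role bs i ≡ loser l → ∃ λ k → (k , l) ∈ bs
loser-∈ ((k′ , l′) ∷ bs) i ρ with i <? k′ | i <? k′ + l′
... | yes i<k | _ with refl ← trans (sym ρ) (role-loser {k′} {l′} {bs} i<k) = k′ , here refl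
... | no i≮k | yes i<s with () ← trans (sym ρ) (role-winner {k′} {l′} {bs} (≮⇒≥ i≮k) i<s)
... | no _ | no i≮s with k , kl∈ ← loser-∈ bs _ (trans (sym (role-outside {k′} {l′} {bs} (≮⇒≥ i≮s))) ρ)
  = k , there kl∈

∈⇒winner : ∀ bs {k l} → (k , l) ∈ bs → 0 ℕ.< l → ∃ λ i → i ℕ.< width bs × role bs i ≡ winner k
∈⇒winner ((k , l) ∷ bs) (here refl) 0<l =
  k , ≤-trans (m<m+n k 0<l) (m≤m+n (k + l) (width bs)) , role-winner {k} {l} {bs} ≤-refl (m<m+n k 0<l)
∈⇒winner ((k′ , l′) ∷ bs) (there kl∈) 0<l with i , i< , ρ ← ∈⇒winner bs kl∈ 0<l =
  (k′ + l′) + i , +-monoʳ-< (k′ + l′) i< , trans (role-shift k′ l′ bs i) ρ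

∈⇒loser : ∀ bs {k l} → (k , l) ∈ bs → 0 ℕ.< k → ∃ λ i → i ℕ.< width bs × role bs i ≡ loser l
∈⇒loser ((k , l) ∷ bs) (here refl) 0<k =
  0 , ≤-trans (≤-trans 0<k (m≤m+n k l)) (m≤m+n (k + l) (width bs)) , role-loser {k} {l} {bs} 0<k
∈⇒loser ((k′ , l′) ∷ bs) (there kl∈) 0<k with i , i< , ρ ← ∈⇒loser bs kl∈ 0<k =
  (k′ + l′) + i , +-monoʳ-< (k′ + l′) i< , trans (role-shift k′ l′ bs i) ρ

fromRelation : ∀ n (A : ℕ → ℕ → Bool) → (∀ i → A i i ≡ false) →
               (∀ i j → i ≢ j → A j i ≡ not (A i j)) → Tournament n
fromRelation n A irrefl antisym = record
  { arc         = λ u v → A (toℕ u) (toℕ v)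
  ; loopless    = irrefl ∘ toℕ
  ; orientation = λ u v u≢v → antisym (toℕ u) (toℕ v) (u≢v ∘ toℕ-injective)
  }

imbalance-fromRelation : ∀ n A irrefl antisym (u : Fin n) →
  imbalance (fromRelation n A irrefl antisym) u ≡ count n (A (toℕ u)) ⊖ count n (λ j → A j (toℕ u))
imbalance-fromRelation n A irrefl antisym u =
  trans ([+m]-[+n]≡m⊖n (outdeg t u) (indeg t u))
        (cong₂ _⊖_ (length-filter-tabulate n (λ v → v) (arc t u) (A (toℕ u)) (λ _ → refl))
                   (length-filter-tabulate n (λ v → v) (λ v → arc t v u) (λ j → A j (toℕ u)) (λ _ → refl)))
  where t = fromRelation n A irrefl antisym

[n+m]⊖n≡m : ∀ n m → (n + m) ⊖ n ≡ + m
[n+m]⊖n≡m n m = trans (cong ((n + m) ⊖_) (sym (+-identityʳ n))) (+-cancelˡ-⊖ n m 0)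

-- In a tournament on 2h+1 vertices outdegree and indegree add up to 2h, so the imbalance
-- is twice the deviation of the outdegree from h.
⊖-surplus : ∀ {h o d} k → o + d ≡ h + h → o ≡ h + k → o ⊖ d ≡ + (2 * k)
⊖-surplus {h} {o} {d} k o+d≡2h refl = begin
  (h + k) ⊖ d               ≡⟨ cong (_⊖ d) o≡d+2k ⟩
  (d + 2 * k) ⊖ d           ≡⟨ [n+m]⊖n≡m d (2 * k) ⟩
  + (2 * k)                 ∎
  where
  open ≡-Reasoning
  k+d≡h : k + d ≡ h
  k+d≡h = +-cancelˡ-≡ h _ _ (trans (sym (+-assoc h k d)) o+d≡2h)
  rearrange : ∀ k d → (k + d) + k ≡ d + 2 * k
  rearrange = solve-∀
  o≡d+2k : h + k ≡ d + 2 * k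
  o≡d+2k = trans (cong (_+ k) (sym k+d≡h)) (rearrange k d)

⊖-deficit : ∀ {h o d} l → o + d ≡ h + h → o + l ≡ h → o ⊖ d ≡ - + (2 * l)
⊖-deficit {h} {o} {d} l o+d≡2h refl = begin
  o ⊖ d                     ≡⟨ cong (o ⊖_) d≡o+2l ⟩
  o ⊖ (o + 2 * l)           ≡⟨ ⊖-swap o (o + 2 * l) ⟩
  - ((o + 2 * l) ⊖ o)       ≡⟨ cong -_ ([n+m]⊖n≡m o (2 * l)) ⟩
  - + (2 * l)               ∎
  where
  open ≡-Reasoning
  rearrange : ∀ o l → (o + l) + (o + l) ≡ o + (l + (o + l))
  rearrange = solve-∀
  rearrange′ : ∀ o l → l + (o + l) ≡ o + 2 * l
  rearrange′ = solve-∀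
  d≡o+2l : d ≡ o + 2 * l
  d≡o+2l = trans (+-cancelˡ-≡ o _ _ (trans o+d≡2h (rearrange o l))) (rearrange′ o l)

surplus : Role → ℤ
surplus (winner k) = + (2 * k)
surplus (loser l)  = - + (2 * l)
surplus bystander  = +0

module BlockTournament (bs : List (ℕ × ℕ)) where

  h : ℕ
  h = width bs

  n : ℕ
  n = suc (h + h)

  arcs : ℕ → ℕ → Bool
  arcs i j = rotational h i j xor reversal bs i j

  arcs-irrefl : ∀ i → arcs i i ≡ false
  arcs-irrefl i rewrite rotational-irrefl h i | reversal-irrefl bs i = refl

  arcs-antisym : ∀ i j → i ≢ j → arcs j i ≡ not (arcs i j)
  arcs-antisym i j i≢j rewrite rotational-antisym h i j i≢j | reversal-sym bs j i =
    sym (not-distribˡ-xor (rotational h i j) (reversal bs i j))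

  tournament : Tournament n
  tournament = fromRelation n arcs arcs-irrefl arcs-antisym

  n≡h+[1+h] : n ≡ h + suc h
  n≡h+[1+h] = sym (+-suc h h)

  module _ (i : ℕ) (i<n : i ℕ.< n) where

    outdegree+indegree : count n (arcs i) + count n (λ j → arcs j i) ≡ h + h
    outdegree+indegree = count-complement-except (h + h) i (arcs i) (λ j → arcs j i) i<n
      (arcs-irrefl i) (arcs-irrefl i) (λ j j≢i → arcs-antisym i j (j≢i ∘ sym))

    count-rotational-n : count n (rotational h i) ≡ h
    count-rotational-n = trans (cong (λ m → count m (rotational h i)) n≡h+[1+h])
                               (count-rotational h (subst (i ℕ.<_) n≡h+[1+h] i<n))

    count-reversal-n : count n (reversal bs i) ≡ reversedDegree (role bs i)
    count-reversal-n = trans (cong (λ m → count m (reversal bs i)) n≡h+[1+h])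
                             (count-reversal bs i (suc h))

    outdegree-disjoint : (∀ j → reversal bs i j ≡ true → rotational h i j ≡ false) →
                         count n (arcs i) ≡ h + reversedDegree (role bs i)
    outdegree-disjoint disjoint =
      trans (count-xor-disjoint n _ _ disjoint) (cong₂ _+_ count-rotational-n count-reversal-n)

    surplus-role : count n (arcs i) ⊖ count n (λ j → arcs j i) ≡ surplus (role bs i)
    surplus-role with role bs i in ρ
    ... | winner k = ⊖-surplus k outdegree+indegree
      (trans (outdegree-disjoint backward) (cong (λ r → h + reversedDegree r) ρ))
      where
      backward : ∀ j → reversal bs i j ≡ true → rotational h i j ≡ false
      backward j r with j<i , near ← reversal-winner bs i j ρ r = rotational-near-backward h j<i near
    ... | loser l = ⊖-deficit l outdegree+indegree
      (trans (cong (λ x → count n (arcs i) + x) (sym (trans count-reversal-n (cong reversedDegree ρ))))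
             (trans (count-xor-⊆ n _ _ forward) count-rotational-n))
      where
      forward : ∀ j → reversal bs i j ≡ true → rotational h i j ≡ true
      forward j r with i<j , near ← reversal-loser bs i j ρ r = rotational-near-forward h i<j near
    ... | bystander = ⊖-surplus 0 outdegree+indegree
      (trans (outdegree-disjoint none) (cong (λ r → h + reversedDegree r) ρ))
      where
      none : ∀ j → reversal bs i j ≡ true → rotational h i j ≡ false
      none j r with () ← trans (sym r) (reversal-bystander bs i j ρ)

  imbalance-tournament : ∀ u → imbalance tournament u ≡ surplus (role bs (toℕ u))
  imbalance-tournament u =
    trans (imbalance-fromRelation n arcs arcs-irrefl arcs-antisym u) (surplus-role (toℕ u) (toℕ<n u))

  imbalance-fromℕ< : ∀ {i} (i<n : i ℕ.< n) → imbalance tournament (fromℕ< i<n) ≡ surplus (role bs i)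
  imbalance-fromℕ< i<n = trans (imbalance-tournament _) (cong (surplus ∘ role bs) (toℕ-fromℕ< i<n))

  width<n : h ℕ.< n
  width<n = s≤s (m≤m+n h h)

block : ℕ → ℕ → ℤ → ℕ × ℕ
block p q (+ m)    = m / 2 , q
block p q -[1+ m ] = p , suc m / 2

2*[n/2]≡n : ∀ {n} → 2 ∣ℕ n → 2 * (n / 2) ≡ n
2*[n/2]≡n = m*[n/m]≡n

-- The premises z ∈ Z of p-valid and q-valid only demand that Z be non-empty.
module _ (Z : List ℤ) (even : All (λ z → + 2 ∣ z) Z) (p q : ℕ)
         (p-valid : ∀ {z} → z ∈ Z → + (2 * p) ∈ Z × 0 ℕ.< p)
         (q-valid : ∀ {z} → z ∈ Z → - + (2 * q) ∈ Z × 0 ℕ.< q) where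

  blocks : List (ℕ × ℕ)
  blocks = map (block p q) Z

  open BlockTournament blocks

  winner-surplus-∈ : ∀ {k l} → (k , l) ∈ blocks → + (2 * k) ∈ Z
  winner-surplus-∈ kl∈ with ∈-map⁻ (block p q) kl∈
  ... | + m    , z∈ , refl = subst (_∈ Z) (cong +_ (sym (2*[n/2]≡n (All.lookup even z∈)))) z∈
  ... | -[1+ m ] , z∈ , refl = proj₁ (p-valid z∈)

  loser-surplus-∈ : ∀ {k l} → (k , l) ∈ blocks → - + (2 * l) ∈ Z
  loser-surplus-∈ kl∈ with ∈-map⁻ (block p q) kl∈
  ... | + m    , z∈ , refl = proj₁ (q-valid z∈)
  ... | -[1+ m ] , z∈ , refl = subst (_∈ Z) (cong (-_ ∘ +_) (sym (2*[n/2]≡n (All.lookup even z∈)))) z∈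

  surplus-role-∈ : ∀ i → surplus (role blocks i) ∈ +0 ∷ Z
  surplus-role-∈ i with role blocks i in ρ
  ... | winner k  = there (winner-surplus-∈ (proj₂ (winner-∈ blocks i ρ)))
  ... | loser l   = there (loser-surplus-∈ (proj₂ (loser-∈ blocks i ρ)))
  ... | bystander = here refl

  attained : ∀ {x} → x ∈ +0 ∷ Z → ∃ λ v → imbalance tournament v ≡ x
  attained (here refl) = fromℕ< width<n ,
    trans (imbalance-fromℕ< width<n)
          (cong surplus (trans (cong (role blocks) (sym (+-identityʳ h))) (role-beyond-width blocks 0)))
  attained (there z∈) = attained-member z∈
    where
    attained-member : ∀ {z} → z ∈ Z → ∃ λ v → imbalance tournament v ≡ z
    attained-member {+ m} z∈
      with i , i<h , ρ ← ∈⇒winner blocks (∈-map⁺ (block p q) z∈) (proj₂ (q-valid z∈)) =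
      fromℕ< (<-trans i<h width<n) ,
      trans (imbalance-fromℕ< (<-trans i<h width<n))
            (trans (cong surplus ρ) (cong +_ (2*[n/2]≡n (All.lookup even z∈))))
    attained-member { -[1+ m ]} z∈
      with i , i<h , ρ ← ∈⇒loser blocks (∈-map⁺ (block p q) z∈) (proj₂ (p-valid z∈)) =
      fromℕ< (<-trans i<h width<n) ,
      trans (imbalance-fromℕ< (<-trans i<h width<n))
            (trans (cong surplus ρ) (cong (-_ ∘ +_) (2*[n/2]≡n (All.lookup even z∈))))

  blockTournament-imbalances : Σ ℕ λ n → Σ (Tournament n) λ t →
    ∀ (x : ℤ) → ((x ∈ (+0 ∷ Z)) ⇔ (∃ λ (v : Fin n) → imbalance t v ≡ x))
  blockTournament-imbalances = n , tournament , λ x → mk⇔ attained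
    λ { (v , refl) → subst (_∈ +0 ∷ Z) (sym (imbalance-tournament v)) (surplus-role-∈ (toℕ v)) }

positive-even : ∀ {z} → + 2 ∣ z → +0 < z → ∃ λ k → z ≡ + (2 * k) × 0 ℕ.< k
positive-even {+ zero}   _   (+<+ ())
positive-even {+[1+ m ]} 2∣z _ = suc m / 2 , cong +_ (sym 2k≡1+m) , k>0 2k≡1+m
  where
  2k≡1+m = 2*[n/2]≡n 2∣z
  k>0 : ∀ {k} → 2 * k ≡ suc m → 0 ℕ.< k
  k>0 {suc k} _ = z<s

negative-even : ∀ {z} → + 2 ∣ z → z < +0 → ∃ λ l → z ≡ - + (2 * l) × 0 ℕ.< l
negative-even {+ _}      _   (+<+ ())
negative-even { -[1+ m ]} 2∣z _ = suc m / 2 , cong (-_ ∘ +_) (sym 2l≡1+m) , l>0 2l≡1+m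
  where
  2l≡1+m = 2*[n/2]≡n 2∣z
  l>0 : ∀ {l} → 2 * l ≡ suc m → 0 ℕ.< l
  l>0 {suc l} _ = z<s

corollary3p5 : (Z : List ℤ) → All (λ z → + 2 ∣ z) Z →
    (Z ≡ [] ⊎ ((∃ λ p → p ∈ Z × +0 < p) × (∃ λ q → q ∈ Z × q < +0))) →
    Σ ℕ λ n → Σ (Tournament n) λ t →
    ∀ (x : ℤ) → ((x ∈ (+0 ∷ Z)) ⇔ (∃ λ (v : Fin n) → imbalance t v ≡ x))
corollary3p5 .[] even (inj₁ refl) = blockTournament-imbalances [] even 0 0 (λ ()) (λ ())
corollary3p5 Z even (inj₂ ((z₊ , z₊∈ , 0<z₊) , (z₋ , z₋∈ , z₋<0)))
  with k , refl , 0<k ← positive-even (All.lookup even z₊∈) 0<z₊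
     | l , refl , 0<l ← negative-even (All.lookup even z₋∈) z₋<0
  = blockTournament-imbalances Z even k l (λ _ → z₊∈ , 0<k) (λ _ → z₋∈ , 0<l)
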